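{- For all integers $n\ge1$ and $m_1,\ldots,m_n\ge 2$, $\nu(m_1,\ldots,m_n)\le 2+\sum_{i=1}^n(m_i-2)$.
   Context: An $n$-uniform hypergraph is $n$-partite if its vertex set is the disjoint union of $n$ sets $V_1,\ldots,V_n$ and each edge meets each $V_i$ in exactly one vertex; it is written $(V_1,\ldots,V_n,E)$. An octahedral system is such a hypergraph with $|V_i|\ge 2$ for all $i$ satisfying the parity condition: for every $X\subseteq\bigcup_i V_i$ with $|X\cap V_i|=2$ for all $i$, the number of edges contained in $X$ is even. It is an $(m_1,\ldots,m_n)$-octahedral system if $|V_i|=m_i$ for all $i$. A vertex is isolated if it belongs to no edge. $\nu(m_1,\ldots,m_n)$ is the minimum number of edges over all $(m_1,\ldots,m_n)$-octahedral systems without isolated vertex. -}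

module Defs where

open import Data.Nat using (ℕ; _∸_; _+_; _≤_; _≥_; _%_)
open import Data.Fin using (Fin; _≟_)
open import Data.Fin.Properties using () renaming (_≟_ to _≟ᶠ_)
open import Data.List using (List; length; filter)
open import Data.List.Relation.Unary.Unique.Propositional using (Unique)
open import Data.List.Relation.Unary.Any using (Any)
open import Data.Product using (Σ; _×_; _,_)
open import Data.Sum using (_⊎_)
open import Relation.Binary.PropositionalEquality using (_≡_; _≢_)
open import Relation.Nullary using (Dec; ¬_)
open import Relation.Nullary.Decidable using (_⊎-dec_)
open import Relation.Unary using (Decidable)

sumFin : (n : ℕ) → (Fin n → ℕ) → ℕ
sumFin ℕ.zero f = 0
sumFin (ℕ.suc n) f = f Fin.zero + sumFin n (λ i → f (Fin.suc i))

-- An n-partite n-uniform hypergraph with parts V_i = Fin (m i).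
-- An edge picks exactly one vertex from each part.
Edge : (n : ℕ) → (Fin n → ℕ) → Set
Edge n m = (i : Fin n) → Fin (m i)

record Hypergraph (n : ℕ) (m : Fin n → ℕ) : Set where
  field
    edges  : List (Edge n m)
    unique : Unique edges
open Hypergraph public

-- A set X with |X ∩ V_i| = 2 for all i: two distinct vertices a i ≠ b i in each part.
record TwoPerPart (n : ℕ) (m : Fin n → ℕ) : Set where
  field
    a b  : Edge n m
    a≢b  : (i : Fin n) → a i ≢ b i
open TwoPerPart public

_⊆X_ : {n : ℕ} {m : Fin n → ℕ} → Edge n m → TwoPerPart n m → Set
_⊆X_ {n} e X = (i : Fin n) → (e i ≡ a X i) ⊎ (e i ≡ b X i)

⊆X-dec : {n : ℕ} {m : Fin n → ℕ} (X : TwoPerPart n m) → Decidable (λ e → e ⊆X X)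
⊆X-dec {n} X e = Data.Fin.Properties.all? (λ i → (e i ≟ᶠ a X i) ⊎-dec (e i ≟ᶠ b X i))
  where import Data.Fin.Properties

edgesIn : {n : ℕ} {m : Fin n → ℕ} → Hypergraph n m → TwoPerPart n m → ℕ
edgesIn H X = length (filter (⊆X-dec X) (edges H))

IsOctahedral : {n : ℕ} {m : Fin n → ℕ} → Hypergraph n m → Set
IsOctahedral {n} {m} H =
  ((i : Fin n) → m i ≥ 2) × ((X : TwoPerPart n m) → edgesIn H X % 2 ≡ 0)

NoIsolated : {n : ℕ} {m : Fin n → ℕ} → Hypergraph n m → Set
NoIsolated {n} {m} H = (i : Fin n) (v : Fin (m i)) → Any (λ e → e i ≡ v) (edges H)

-- ν(m) ≤ k : some (m_1,…,m_n)-octahedral system without isolated vertex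
-- has at most k edges (ν is the minimum over such systems).
ν≤ : (n : ℕ) (m : Fin n → ℕ) → ℕ → Set
ν≤ n m k = Σ (Hypergraph n m) λ H → IsOctahedral H × NoIsolated H × length (edges H) ≤ k

module Submission where

-- We build, by induction on n, an octahedral system without isolated vertex
-- with exactly 2 + Σᵢ (mᵢ − 2) edges, together with a distinguished edge p.
-- Number the vertices of each part 0, 1, 2, ….
--   * n = 1: the edges are all m₁ singletons {v}; every X contains exactly 2.
--   * n → n + 1: from a system (p, rest) on the last n parts, take the edges
--     (1, p), (0, e) for e ∈ rest, and (w, p) for w ≥ 2.  This adds m − 2
--     edges.  For X meeting the new part in {a, b}, write δ(w) = [w ∈ {a,b}];
--     the number of edges in X is δ(1)·i + δ(0)·c + Σ_{w≥2} δ(w)·i, where i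
--     counts p and c counts rest inside the restriction of X.  As
--     Σ_w δ(w) = 2, this is 2i when δ(0) = 0, and i + c (even by induction)
--     when δ(0) = 1.
-- The file first develops counting with indicators over lists, then the
-- enumeration of a part Fin M as 0 ∷ 1 ∷ others, then how containment in X
-- factors through the first part, and finally the inductive construction.

open import Defs
open import Data.Nat using (ℕ; _+_; _∸_; _≤_; _≥_)
open import Data.Fin using (Fin)

open import Data.Nat using (zero; suc; _*_; _%_; s≤s; z≤n)
open import Data.Nat.DivMod using (m*n%n≡0)
open import Data.Nat.Properties using (+-assoc; +-comm; +-identityʳ; *-zeroʳ; *-distribˡ-+; *-distribʳ-+; suc-injective; ≤-reflexive)
open import Data.Nat.Tactic.RingSolver using (solve-∀)
open import Data.Fin using (zero; suc)
open import Data.Fin.Properties using (_≟_) renaming (suc-injective to fsuc-injective)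
open import Data.List using (List; []; _∷_; map; _++_; length; filter; tabulate; allFin)
open import Data.List.Properties using (length-map; length-++; length-tabulate; map-tabulate)
open import Data.List.Relation.Unary.Any using (Any; here; there)
import Data.List.Relation.Unary.Any.Properties as Any
open import Data.List.Relation.Unary.All using () renaming (tabulate to all-tabulate)
open import Data.List.Relation.Unary.AllPairs using (_∷_)
open import Data.List.Relation.Unary.Unique.Propositional using (Unique)
import Data.List.Relation.Unary.Unique.Propositional.Properties as Unique
open import Data.List.Membership.Propositional using (_∈_; lose)
open import Data.List.Membership.Propositional.Properties using (∈-map⁺; ∈-map⁻; ∈-++⁺ˡ; ∈-++⁺ʳ; ∈-++⁻; ∈-allFin; ∈-tabulate⁻)
open import Data.Product using (Σ; ∃; _×_; _,_; proj₁; proj₂)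
open import Data.Sum using (_⊎_; inj₁; inj₂)
open import Data.Empty using (⊥-elim)
open import Relation.Nullary using (Dec; yes; no; ¬_)
open import Relation.Nullary.Decidable using (_⊎-dec_; _×-dec_)
open import Relation.Binary.PropositionalEquality using (_≡_; _≢_; refl; sym; trans; cong; cong₂; subst; module ≡-Reasoning)

𝟙 : {P : Set} → Dec P → ℕ
𝟙 (yes _) = 1
𝟙 (no _)  = 0

𝟙-yes : {P : Set} → P → (d : Dec P) → 𝟙 d ≡ 1
𝟙-yes p (yes _) = refl
𝟙-yes p (no ¬p) = ⊥-elim (¬p p)

𝟙-no : {P : Set} → ¬ P → (d : Dec P) → 𝟙 d ≡ 0
𝟙-no ¬p (yes p) = ⊥-elim (¬p p)
𝟙-no ¬p (no _)  = refl

𝟙-bit : {P : Set} (d : Dec P) → (𝟙 d ≡ 0) ⊎ (𝟙 d ≡ 1)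
𝟙-bit (yes _) = inj₂ refl
𝟙-bit (no _)  = inj₁ refl

𝟙-cong : {P Q : Set} (d : Dec P) (e : Dec Q) → (P → Q) → (Q → P) → 𝟙 d ≡ 𝟙 e
𝟙-cong (yes _) (yes _) _ _ = refl
𝟙-cong (yes p) (no ¬q) f _ = ⊥-elim (¬q (f p))
𝟙-cong (no ¬p) (yes q) _ g = ⊥-elim (¬p (g q))
𝟙-cong (no _)  (no _)  _ _ = refl

𝟙-× : {P Q : Set} (d : Dec P) (e : Dec Q) → 𝟙 (d ×-dec e) ≡ 𝟙 d * 𝟙 e
𝟙-× (yes _) (yes _) = refl
𝟙-× (yes _) (no _)  = refl
𝟙-× (no _)  (yes _) = refl
𝟙-× (no _)  (no _)  = refl

𝟙-⊎ : {P Q : Set} (d : Dec P) (e : Dec Q) → ¬ (P × Q) → 𝟙 (d ⊎-dec e) ≡ 𝟙 d + 𝟙 e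
𝟙-⊎ (yes p) (yes q) excl = ⊥-elim (excl (p , q))
𝟙-⊎ (yes _) (no _)  _    = refl
𝟙-⊎ (no _)  (yes _) _    = refl
𝟙-⊎ (no _)  (no _)  _    = refl

sumOver : {A : Set} → (A → ℕ) → List A → ℕ
sumOver f []       = 0
sumOver f (x ∷ xs) = f x + sumOver f xs

sumOver-cong : {A : Set} {f g : A → ℕ} (xs : List A) → (∀ x → f x ≡ g x) → sumOver f xs ≡ sumOver g xs
sumOver-cong []       f≗g = refl
sumOver-cong (x ∷ xs) f≗g = cong₂ _+_ (f≗g x) (sumOver-cong xs f≗g)

sumOver-zero : {A : Set} {f : A → ℕ} (xs : List A) → (∀ x → f x ≡ 0) → sumOver f xs ≡ 0
sumOver-zero []       f≗0 = refl
sumOver-zero (x ∷ xs) f≗0 = cong₂ _+_ (f≗0 x) (sumOver-zero xs f≗0)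

sumOver-+ : {A : Set} (f g : A → ℕ) (xs : List A) →
  sumOver (λ x → f x + g x) xs ≡ sumOver f xs + sumOver g xs
sumOver-+ f g []       = refl
sumOver-+ f g (x ∷ xs) =
  trans (cong (f x + g x +_) (sumOver-+ f g xs)) (interchange (f x) (g x) (sumOver f xs) (sumOver g xs))
  where
  interchange : ∀ a b c d → (a + b) + (c + d) ≡ (a + c) + (b + d)
  interchange = solve-∀

sumOver-++ : {A : Set} (f : A → ℕ) (xs ys : List A) → sumOver f (xs ++ ys) ≡ sumOver f xs + sumOver f ys
sumOver-++ f []       ys = refl
sumOver-++ f (x ∷ xs) ys = trans (cong (f x +_) (sumOver-++ f xs ys)) (sym (+-assoc (f x) _ _))

sumOver-map : {A B : Set} (f : B → ℕ) (g : A → B) (xs : List A) →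
  sumOver f (map g xs) ≡ sumOver (λ x → f (g x)) xs
sumOver-map f g []       = refl
sumOver-map f g (x ∷ xs) = cong (f (g x) +_) (sumOver-map f g xs)

length-filter≡sumOver : {A : Set} {P : A → Set} (P? : (x : A) → Dec (P x)) (xs : List A) →
  length (filter P? xs) ≡ sumOver (λ x → 𝟙 (P? x)) xs
length-filter≡sumOver P? []       = refl
length-filter≡sumOver P? (x ∷ xs) with P? x
... | yes _ = cong suc (length-filter≡sumOver P? xs)
... | no _  = length-filter≡sumOver P? xs

member-of-nonempty : {A : Set} (xs : List A) {k : ℕ} → length xs ≡ suc k → Σ A (_∈ xs)
member-of-nonempty (x ∷ _) _ = x , here refl

allFin-suc : (N : ℕ) → allFin (suc N) ≡ zero ∷ map suc (allFin N)
allFin-suc N = cong (zero ∷_) (sym (map-tabulate (λ i → i) suc))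

count-singleton : {N : ℕ} (a : Fin N) → sumOver (λ w → 𝟙 (w ≟ a)) (allFin N) ≡ 1
count-singleton {suc N} zero = begin
  sumOver (λ w → 𝟙 (w ≟ zero)) (allFin (suc N))
    ≡⟨ cong (sumOver (λ w → 𝟙 (w ≟ zero))) (allFin-suc N) ⟩
  1 + sumOver (λ w → 𝟙 (w ≟ zero)) (map suc (allFin N))
    ≡⟨ cong (1 +_) (sumOver-map _ suc (allFin N)) ⟩
  1 + sumOver (λ w → 𝟙 (suc w ≟ zero)) (allFin N)
    ≡⟨ cong (1 +_) (sumOver-zero (allFin N) (λ w → 𝟙-no (λ ()) (suc w ≟ zero))) ⟩
  1 ∎
  where open ≡-Reasoning
count-singleton {suc N} (suc a) = begin
  sumOver (λ w → 𝟙 (w ≟ suc a)) (allFin (suc N))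
    ≡⟨ cong (sumOver (λ w → 𝟙 (w ≟ suc a))) (allFin-suc N) ⟩
  0 + sumOver (λ w → 𝟙 (w ≟ suc a)) (map suc (allFin N))
    ≡⟨ sumOver-map _ suc (allFin N) ⟩
  sumOver (λ w → 𝟙 (suc w ≟ suc a)) (allFin N)
    ≡⟨ sumOver-cong (allFin N) (λ w → 𝟙-cong (suc w ≟ suc a) (w ≟ a) fsuc-injective (cong suc)) ⟩
  sumOver (λ w → 𝟙 (w ≟ a)) (allFin N)              ≡⟨ count-singleton a ⟩
  1 ∎
  where open ≡-Reasoning

δ : {M : ℕ} (a b w : Fin M) → Dec ((w ≡ a) ⊎ (w ≡ b))
δ a b w = (w ≟ a) ⊎-dec (w ≟ b)

count-pair : {N : ℕ} (a b : Fin N) → a ≢ b → sumOver (λ w → 𝟙 (δ a b w)) (allFin N) ≡ 2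
count-pair {N} a b a≢b = begin
  sumOver (λ w → 𝟙 (δ a b w)) (allFin N)
    ≡⟨ sumOver-cong (allFin N) (λ w → 𝟙-⊎ (w ≟ a) (w ≟ b) (λ (w≡a , w≡b) → a≢b (trans (sym w≡a) w≡b))) ⟩
  sumOver (λ w → 𝟙 (w ≟ a) + 𝟙 (w ≟ b)) (allFin N)
    ≡⟨ sumOver-+ _ _ (allFin N) ⟩
  sumOver (λ w → 𝟙 (w ≟ a)) (allFin N) + sumOver (λ w → 𝟙 (w ≟ b)) (allFin N)
    ≡⟨ cong₂ _+_ (count-singleton a) (count-singleton b) ⟩
  2 ∎
  where open ≡-Reasoning

vertex0 : {M : ℕ} → M ≥ 2 → Fin M
vertex0 (s≤s (s≤s z≤n)) = zero

vertex1 : {M : ℕ} → M ≥ 2 → Fin M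
vertex1 (s≤s (s≤s z≤n)) = suc zero

others : {M : ℕ} → M ≥ 2 → List (Fin M)
others (s≤s (s≤s z≤n)) = tabulate (λ i → suc (suc i))

enumerate : {M : ℕ} (M≥2 : M ≥ 2) → vertex0 M≥2 ∷ vertex1 M≥2 ∷ others M≥2 ≡ allFin M
enumerate (s≤s (s≤s z≤n)) = refl

vertex0≢vertex1 : {M : ℕ} (M≥2 : M ≥ 2) → vertex0 M≥2 ≢ vertex1 M≥2
vertex0≢vertex1 (s≤s (s≤s z≤n)) ()

others-avoid : {M : ℕ} (M≥2 : M ≥ 2) {w : Fin M} → w ∈ others M≥2 → (vertex0 M≥2 ≢ w) × (vertex1 M≥2 ≢ w)
others-avoid (s≤s (s≤s z≤n)) w∈ with ∈-tabulate⁻ w∈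
... | _ , refl = (λ ()) , (λ ())

others-length : {M : ℕ} (M≥2 : M ≥ 2) → length (others M≥2) ≡ M ∸ 2
others-length (s≤s (s≤s z≤n)) = length-tabulate _

enumerate-unique : {M : ℕ} (M≥2 : M ≥ 2) → Unique (vertex0 M≥2 ∷ vertex1 M≥2 ∷ others M≥2)
enumerate-unique {M} M≥2 = subst Unique (sym (enumerate M≥2)) (Unique.allFin⁺ M)

others-unique : {M : ℕ} (M≥2 : M ≥ 2) → Unique (others M≥2)
others-unique M≥2 with enumerate-unique M≥2
... | _ ∷ _ ∷ unique = unique

vertex-cases : {M : ℕ} (M≥2 : M ≥ 2) (v : Fin M) →
  (v ≡ vertex0 M≥2) ⊎ (v ≡ vertex1 M≥2) ⊎ (v ∈ others M≥2)
vertex-cases M≥2 v with subst (v ∈_) (sym (enumerate M≥2)) (∈-allFin v)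
... | here v≡0          = inj₁ v≡0
... | there (here v≡1)  = inj₂ (inj₁ v≡1)
... | there (there v∈)  = inj₂ (inj₂ v∈)

count-pair-enumerated : {M : ℕ} (M≥2 : M ≥ 2) (a b : Fin M) → a ≢ b →
  sumOver (λ w → 𝟙 (δ a b w)) (vertex0 M≥2 ∷ vertex1 M≥2 ∷ others M≥2) ≡ 2
count-pair-enumerated M≥2 a b a≢b = trans (cong (sumOver _) (enumerate M≥2)) (count-pair a b a≢b)

count : {n : ℕ} {m : Fin n → ℕ} → TwoPerPart n m → List (Edge n m) → ℕ
count X = sumOver (λ e → 𝟙 (⊆X-dec X e))

module FirstPart {n : ℕ} {m : Fin (suc n) → ℕ} where

  restSizes : Fin n → ℕ
  restSizes i = m (suc i)

  _◂_ : Fin (m zero) → Edge n restSizes → Edge (suc n) m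
  (w ◂ e) zero    = w
  (w ◂ e) (suc i) = e i

  ◂-injectiveʳ : {w w′ : Fin (m zero)} {e e′ : Edge n restSizes} → w ◂ e ≡ w′ ◂ e′ → e ≡ e′
  ◂-injectiveʳ eq = cong (λ f i → f (suc i)) eq

  ◂-injectiveˡ : {w w′ : Fin (m zero)} {e e′ : Edge n restSizes} → w ◂ e ≡ w′ ◂ e′ → w ≡ w′
  ◂-injectiveˡ eq = cong (λ f → f zero) eq

  restX : TwoPerPart (suc n) m → TwoPerPart n restSizes
  restX X = record { a = λ i → a X (suc i) ; b = λ i → b X (suc i) ; a≢b = λ i → a≢b X (suc i) }

  δX : TwoPerPart (suc n) m → Fin (m zero) → ℕ
  δX X w = 𝟙 (δ (a X zero) (b X zero) w)

  𝟙-◂ : (X : TwoPerPart (suc n) m) (w : Fin (m zero)) (e : Edge n restSizes) →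
    𝟙 (⊆X-dec X (w ◂ e)) ≡ δX X w * 𝟙 (⊆X-dec (restX X) e)
  𝟙-◂ X w e = trans
    (𝟙-cong (⊆X-dec X (w ◂ e)) (δ (a X zero) (b X zero) w ×-dec ⊆X-dec (restX X) e)
      (λ w◂e⊆X → w◂e⊆X zero , λ i → w◂e⊆X (suc i))
      (λ { (w∈X , e⊆X) zero → w∈X ; (w∈X , e⊆X) (suc i) → e⊆X i }))
    (𝟙-× (δ (a X zero) (b X zero) w) (⊆X-dec (restX X) e))

  count-fixed-vertex : (X : TwoPerPart (suc n) m) (w : Fin (m zero)) (es : List (Edge n restSizes)) →
    count X (map (w ◂_) es) ≡ δX X w * count (restX X) es
  count-fixed-vertex X w []       = sym (*-zeroʳ (δX X w))
  count-fixed-vertex X w (e ∷ es) =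
    trans (cong₂ _+_ (𝟙-◂ X w e) (count-fixed-vertex X w es)) (sym (*-distribˡ-+ (δX X w) _ _))

  count-fixed-edge : (X : TwoPerPart (suc n) m) (ws : List (Fin (m zero))) (e : Edge n restSizes) →
    count X (map (_◂ e) ws) ≡ sumOver (δX X) ws * 𝟙 (⊆X-dec (restX X) e)
  count-fixed-edge X []       e = refl
  count-fixed-edge X (w ∷ ws) e =
    trans (cong₂ _+_ (𝟙-◂ X w e) (count-fixed-edge X ws e)) (sym (*-distribʳ-+ _ (δX X w) _))

open FirstPart

-- Evenness in the witness form that the final `% 2` computation consumes.
Even : ℕ → Set
Even c = ∃ λ k → c ≡ k * 2

parity-step : (δ₀ δ₁ s i c : ℕ) → (δ₀ ≡ 0) ⊎ (δ₀ ≡ 1) → δ₀ + (δ₁ + s) ≡ 2 → Even (i + c) →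
  Even (δ₁ * i + (δ₀ * c + s * i))
parity-step .0 δ₁ s i c (inj₁ refl) total _ = i , (begin
  δ₁ * i + s * i  ≡⟨ sym (*-distribʳ-+ i δ₁ s) ⟩
  (δ₁ + s) * i    ≡⟨ cong (_* i) total ⟩
  2 * i           ≡⟨ double i ⟩
  i * 2           ∎)
  where
  open ≡-Reasoning
  double : ∀ i → 2 * i ≡ i * 2
  double = solve-∀
parity-step .1 δ₁ s i c (inj₂ refl) total (k , i+c≡2k) = k , (begin
  δ₁ * i + (1 * c + s * i)  ≡⟨ regroup δ₁ s i c ⟩
  (δ₁ + s) * i + c          ≡⟨ cong (λ t → t * i + c) (suc-injective total) ⟩
  1 * i + c                 ≡⟨ cong (_+ c) (+-identityʳ i) ⟩
  i + c                     ≡⟨ i+c≡2k ⟩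
  k * 2                     ∎)
  where
  open ≡-Reasoning
  regroup : ∀ δ₁ s i c → δ₁ * i + (1 * c + s * i) ≡ (δ₁ + s) * i + c
  regroup = solve-∀

record PointedSystem (n : ℕ) (m : Fin n → ℕ) : Set where
  field
    p        : Edge n m
    rest     : List (Edge n m)
    distinct : Unique (p ∷ rest)
    parity   : (X : TwoPerPart n m) → Even (count X (p ∷ rest))
    covers   : (i : Fin n) (v : Fin (m i)) → Any (λ e → e i ≡ v) (p ∷ rest)
    size     : length (p ∷ rest) ≡ 2 + sumFin n (λ i → m i ∸ 2)

single-part : {m : Fin 1 → ℕ} → m zero ≥ 2 → PointedSystem 1 m
single-part {m} M≥2 = record
  { p        = singleton (vertex0 M≥2)
  ; rest     = map singleton (vertex1 M≥2 ∷ others M≥2)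
  ; distinct = Unique.map⁺ ◂-injectiveˡ (enumerate-unique M≥2)
  ; parity   = λ X → 1 , trans (count-fixed-edge X (vertex0 M≥2 ∷ vertex1 M≥2 ∷ others M≥2) empty)
      (cong₂ _*_ (count-pair-enumerated M≥2 _ _ (a≢b X zero)) (𝟙-yes (λ ()) (⊆X-dec (restX X) empty)))
  ; covers   = λ { zero v → lose (∈-map⁺ singleton (subst (v ∈_) (sym (enumerate M≥2)) (∈-allFin v))) refl }
  ; size     = cong (λ t → 2 + t) (trans (length-map singleton (others M≥2))
                                        (trans (others-length M≥2) (sym (+-identityʳ _))))
  }
  where
  empty : Edge 0 (λ i → m (suc i))
  empty ()
  singleton : Fin (m zero) → Edge 1 m
  singleton w = w ◂ empty

add-part : {n : ℕ} {m : Fin (suc n) → ℕ} → m zero ≥ 2 → PointedSystem n (λ i → m (suc i)) → PointedSystem (suc n) m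
add-part {n} {m} M≥2 S = record
  { p        = p′
  ; rest     = old ++ new
  ; distinct = all-tabulate p′-fresh ∷ Unique.++⁺ (Unique.map⁺ ◂-injectiveʳ rest-unique)
                                                  (Unique.map⁺ ◂-injectiveˡ (others-unique M≥2)) old∩new
  ; parity   = parity′
  ; covers   = covers′
  ; size     = size′
  }
  where
  open PointedSystem S
  v₀ v₁ : Fin (m zero)
  v₀ = vertex0 M≥2
  v₁ = vertex1 M≥2
  from-v₀ : Edge n (λ i → m (suc i)) → Edge (suc n) m
  from-v₀ e = v₀ ◂ e
  with-p : Fin (m zero) → Edge (suc n) m
  with-p w = w ◂ p
  p′ : Edge (suc n) m
  p′ = v₁ ◂ p
  old new : List (Edge (suc n) m)
  old = map from-v₀ rest
  new = map with-p (others M≥2)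

  rest-unique : Unique rest
  rest-unique with distinct
  ... | _ ∷ distinct-rest = distinct-rest

  p′-fresh : {x : Edge (suc n) m} → x ∈ old ++ new → p′ ≢ x
  p′-fresh x∈ with ∈-++⁻ old x∈
  ... | inj₁ x∈old with ∈-map⁻ from-v₀ x∈old
  ...   | _ , _ , refl = λ eq → vertex0≢vertex1 M≥2 (sym (◂-injectiveˡ eq))
  p′-fresh x∈ | inj₂ x∈new with ∈-map⁻ with-p x∈new
  ...   | _ , w∈ , refl = λ eq → proj₂ (others-avoid M≥2 w∈) (◂-injectiveˡ eq)

  old∩new : {x : Edge (suc n) m} → ¬ ((x ∈ old) × (x ∈ new))
  old∩new (x∈old , x∈new) with ∈-map⁻ from-v₀ x∈old | ∈-map⁻ with-p x∈new
  ... | _ , _ , refl | _ , w∈ , eq = proj₁ (others-avoid M≥2 w∈) (◂-injectiveˡ eq)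

  parity′ : (X : TwoPerPart (suc n) m) → Even (count X (p′ ∷ old ++ new))
  parity′ X = subst Even (sym decomposition)
    (parity-step (δX X v₀) (δX X v₁) (sumOver (δX X) (others M≥2)) i c
      (𝟙-bit (δ (a X zero) (b X zero) v₀)) (count-pair-enumerated M≥2 _ _ (a≢b X zero)) (parity (restX X)))
    where
    i c : ℕ
    i = 𝟙 (⊆X-dec (restX X) p)
    c = count (restX X) rest
    decomposition : count X (p′ ∷ old ++ new) ≡ δX X v₁ * i + (δX X v₀ * c + sumOver (δX X) (others M≥2) * i)
    decomposition = cong₂ _+_ (𝟙-◂ X v₁ p)
      (trans (sumOver-++ _ old new) (cong₂ _+_ (count-fixed-vertex X v₀ rest) (count-fixed-edge X (others M≥2) p)))

  covers′ : (i : Fin (suc n)) (v : Fin (m i)) → Any (λ e → e i ≡ v) (p′ ∷ old ++ new)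
  covers′ zero v with vertex-cases M≥2 v
  ... | inj₁ refl       = there (lose (∈-++⁺ˡ (∈-map⁺ from-v₀ (proj₂ (member-of-nonempty rest (suc-injective size))))) refl)
  ... | inj₂ (inj₁ refl) = here refl
  ... | inj₂ (inj₂ v∈)  = there (lose (∈-++⁺ʳ old (∈-map⁺ with-p v∈)) refl)
  covers′ (suc i) v with covers i v
  ... | here p∋v     = here p∋v
  ... | there rest∋v = there (Any.++⁺ˡ (Any.map⁺ rest∋v))

  size′ : length (p′ ∷ old ++ new) ≡ 2 + sumFin (suc n) (λ i → m i ∸ 2)
  size′ = cong suc (begin
    length (old ++ new)                        ≡⟨ length-++ old ⟩
    length old + length new                    ≡⟨ cong₂ _+_ (length-map _ rest) (trans (length-map _ (others M≥2)) (others-length M≥2)) ⟩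
    length rest + (m zero ∸ 2)                 ≡⟨ cong (_+ (m zero ∸ 2)) (suc-injective size) ⟩
    suc (S′ + (m zero ∸ 2))                    ≡⟨ cong suc (+-comm S′ (m zero ∸ 2)) ⟩
    suc ((m zero ∸ 2) + S′)                    ∎)
    where
    open ≡-Reasoning
    S′ : ℕ
    S′ = sumFin n (λ i → m (suc i) ∸ 2)

construct : (n : ℕ) (m : Fin (suc n) → ℕ) → ((i : Fin (suc n)) → m i ≥ 2) → PointedSystem (suc n) m
construct zero    m m≥2 = single-part (m≥2 zero)
construct (suc n) m m≥2 = add-part (m≥2 zero) (construct n (λ i → m (suc i)) (λ i → m≥2 (suc i)))

proposition2p4 : (n : ℕ) → n ≥ 1 → (m : Fin n → ℕ) → ((i : Fin n) → m i ≥ 2) →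
    ν≤ n m (2 + sumFin n (λ i → m i ∸ 2))
proposition2p4 (suc n) _ m m≥2 = H , (m≥2 , even-count) , covers , ≤-reflexive size
  where
  open PointedSystem (construct n m m≥2)
  H : Hypergraph (suc n) m
  H = record { edges = p ∷ rest ; unique = distinct }
  even-count : (X : TwoPerPart (suc n) m) → edgesIn H X % 2 ≡ 0
  even-count X with parity X
  ... | k , count≡2k = trans (cong (_% 2) (trans (length-filter≡sumOver (⊆X-dec X) (p ∷ rest)) count≡2k)) (m*n%n≡0 k 2)
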